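{- Every finite connected graph $G$ has a spanning tree $T$ together with an alternating sign $\phi: E(T) \to \{+,-\}$ on $T$.
   Context: For a spanning tree $T$ of a connected graph $G$, a labelling $\phi: E(T)\to\{+,-\}$ is called an alternating sign on $T$ if for every cotree edge $e \in E(G)\setminus E(T)$, the unique path $v_0, v_1, \ldots, v_\ell$ in $T$ joining the two end vertices of $e$ satisfies $\phi(v_i v_{i+1}) \neq \phi(v_{i+1} v_{i+2})$ for all $i = 0, 1, \ldots, \ell-2$ (i.e., consecutive edges along the path receive different signs). -}

module Defs where

open import Data.Nat using (ℕ; _≤_; suc)
open import Data.Fin using (Fin)
open import Data.Bool using (Bool; true; false)
open import Data.List using (List; []; _∷_)
open import Data.List.Relation.Unary.Unique.Propositional using (Unique)
open import Data.Product using (Σ; _×_; _,_)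
open import Data.Unit using (⊤)
open import Data.Empty using (⊥)
open import Relation.Nullary using (¬_)
open import Relation.Binary.PropositionalEquality using (_≡_; _≢_)

record Graph (n : ℕ) : Set where
  field
    adj     : Fin n → Fin n → Bool
    adj-sym : ∀ u v → adj u v ≡ adj v u
    irrefl  : ∀ u → adj u u ≡ false
open Graph public

Rel : ℕ → Set
Rel n = Fin n → Fin n → Bool

data Walk {n : ℕ} (R : Rel n) : Fin n → Fin n → Set where
  []  : ∀ {u} → Walk R u u
  _∷_ : ∀ {u w v} → R u w ≡ true → Walk R w v → Walk R u v

vertices : ∀ {n} {R : Rel n} {u v} → Walk R u v → List (Fin n)
vertices {u = u} []      = u ∷ []
vertices {u = u} (_ ∷ p) = u ∷ vertices p

len : ∀ {n} {R : Rel n} {u v} → Walk R u v → ℕ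
len []      = 0
len (_ ∷ p) = suc (len p)

IsPath : ∀ {n} {R : Rel n} {u v} → Walk R u v → Set
IsPath p = Unique (vertices p)

Connected : ∀ {n} → Rel n → Set
Connected {n} R = ∀ (u v : Fin n) → Walk R u v

HasCycle : ∀ {n} → Rel n → Set
HasCycle {n} R =
  Σ (Fin n) λ u → Σ (Fin n) λ v → Σ (Walk R u v) λ p →
    IsPath p × (2 ≤ len p) × (R v u ≡ true)

Acyclic : ∀ {n} → Rel n → Set
Acyclic R = ¬ HasCycle R

record IsSpanningTree {n : ℕ} (G : Graph n) (T : Rel n) : Set where
  field
    sub     : ∀ u v → T u v ≡ true → adj G u v ≡ true
    T-sym   : ∀ u v → T u v ≡ T v u
    conn    : Connected T
    acyclic : Acyclic T

AltWalk : ∀ {n} {R : Rel n} (φ : Fin n → Fin n → Bool) {u v} → Walk R u v → Set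
AltWalk φ [] = ⊤
AltWalk φ (_ ∷ []) = ⊤
AltWalk φ {u} (_∷_ {w = w} _ (_∷_ {w = x} e q)) =
  (φ u w ≢ φ w x) × AltWalk φ (e ∷ q)

-- φ is a sign labelling of the edges of T (true = +, false = −); since edges
-- are unordered, φ must give the same value to both orientations of an edge.
IsEdgeLabelling : ∀ {n} → Rel n → (Fin n → Fin n → Bool) → Set
IsEdgeLabelling {n} T φ = ∀ (u v : Fin n) → T u v ≡ true → φ u v ≡ φ v u

-- φ is an alternating sign on the spanning tree T of G: for every cotree
-- edge uv, the (unique) path in T joining u and v alternates in sign.
IsAlternatingSign : ∀ {n} (G : Graph n) (T : Rel n) → (Fin n → Fin n → Bool) → Set
IsAlternatingSign {n} G T φ =
  IsEdgeLabelling T φ ×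
  (∀ (u v : Fin n) → adj G u v ≡ true → T u v ≡ false →
     ∀ (p : Walk T u v) → IsPath p → AltWalk φ p)

-- Build a depth-first search tree T from some root.  Such a tree is normal: the ends of
-- every edge of G are comparable in the tree order (one lies on the path from the other
-- to the root).  Hence the T-path joining the ends of a cotree edge never turns: it runs
-- monotonically along a root path, so signing every tree edge by the parity of the depth
-- of its lower end makes consecutive edges of such a path alternate.
module Submission where

open import Defs
open import Data.Nat using (ℕ; zero; suc; _+_; _≤_; _<_; _⊔_; s≤s; _≟_)
open import Data.Nat.Properties
  using (≤-refl; ≤-trans; ≤-reflexive; n≤1+n; <-irrefl; +-cancelʳ-≡; +-suc; m≢1+n+m; ⊔-comm; m≥n⇒m⊔n≡m)
open import Data.Fin using (Fin; zero; suc) renaming (_≟_ to _≟ᶠ_)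
open import Data.Bool using (Bool; true; not; _∨_)
open import Data.Bool.Properties using (∨-comm; not-¬) renaming (_≟_ to _≟ᵇ_)
open import Data.List using (List; []; _∷_)
open import Data.List.Relation.Unary.AllPairs using (AllPairs; []; _∷_)
import Data.List.Relation.Unary.AllPairs as AllPairs
open import Data.List.Relation.Unary.All using (All; []; _∷_)
import Data.List.Relation.Unary.All as All
open import Data.Product using (Σ; Σ-syntax; ∃-syntax; _×_; _,_; proj₁; proj₂)
open import Data.Sum using (_⊎_; inj₁; inj₂; [_,_]′)
import Data.Sum as Sum
open import Data.Unit using (⊤; tt)
open import Data.Empty using (⊥-elim)
open import Function using (_∘_; const; id; flip)
open import Data.Fin.Subset using (Subset; _∈_; _∉_; _-_; ⁅_⁆; ∁; ∣_∣)
open import Data.Fin.Subset.Properties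
  using (_∈?_; x∈p∧x≢y⇒x∈p-y; p─q⊆p; x∈p⇒∣p-x∣<∣p∣; x∈⁅x⁆; x∈⁅y⁆⇒x≡y; x∈p⇒x∉∁p; x∉∁p⇒x∈p)
open import Data.List.Membership.Propositional using () renaming (_∈_ to _∈ₗ_)
open import Data.List.Relation.Unary.Any using (here; there)
open import Data.List.Membership.Propositional.Properties using (∉[])
open import Data.Fin.Properties using (any?)
open import Induction.WellFounded using (Acc; acc)
open import Data.Nat.Induction using (<-wellFounded)
open import Data.Vec using (_∷_; there)
open import Data.Vec.Functional using (updateAt)
open import Data.Vec.Functional.Properties using (updateAt-updates; updateAt-minimal)
open import Relation.Nullary using (¬_; Dec; yes; no)
open import Relation.Nullary.Decidable using (⌊_⌋; _×-dec_)
open import Relation.Binary.PropositionalEquality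

even : ℕ → Bool
even zero    = true
even (suc k) = not (even k)

_++ʷ_ : ∀ {n} {R : Rel n} {u v w} → Walk R u v → Walk R v w → Walk R u w
[]      ++ʷ q = q
(e ∷ p) ++ʷ q = e ∷ (p ++ʷ q)

gap-one : ∀ {a b ℓ} → a ≡ ℓ + b → a ≡ suc b ⊎ b ≡ suc a → ℓ ≡ 1
gap-one {b = b} {ℓ} a≡ℓ+b (inj₁ a≡1+b) = +-cancelʳ-≡ b ℓ 1 (trans (sym a≡ℓ+b) a≡1+b)
gap-one {b = b}     a≡ℓ+b (inj₂ b≡1+a) = ⊥-elim (m≢1+n+m b (trans b≡1+a (cong suc a≡ℓ+b)))

x∉p-x : ∀ {n} (x : Fin n) (p : Subset n) → x ∉ p - x
x∉p-x zero    (_ ∷ _) ()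
x∉p-x (suc x) (_ ∷ p) (there x∈p-x) = x∉p-x x p x∈p-x

x∉p⇒x∉p-y : ∀ {n} {x y : Fin n} {p : Subset n} → x ∉ p → x ∉ p - y
x∉p⇒x∉p-y {y = y} {p} x∉p x∈p-y = x∉p (p─q⊆p p ⁅ y ⁆ x∈p-y)

x∉p-y⇒x≡y⊎x∉p : ∀ {n} {x y : Fin n} {p : Subset n} → x ∉ p - y → x ≡ y ⊎ x ∉ p
x∉p-y⇒x≡y⊎x∉p {x = x} {y} x∉p-y with x ≟ᶠ y
... | yes x≡y = inj₁ x≡y
... | no  x≢y = inj₂ (λ x∈p → x∉p-y (x∈p∧x≢y⇒x∈p-y x∈p x≢y))

All-vertices-head : ∀ {n} {R : Rel n} {P : Fin n → Set} {u v} (p : Walk R u v) →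
  All P (vertices p) → P u
All-vertices-head []      (pu ∷ _) = pu
All-vertices-head (_ ∷ _) (pu ∷ _) = pu

-- A rooted tree encoded by parent pointers; the depth singles out the root, whose parent is junk.
module TreeOrder {n : ℕ} (parent : Fin n → Fin n) (depth : Fin n → ℕ) where

  Child : Fin n → Fin n → Set
  Child x y = depth x ≡ suc (depth y) × parent x ≡ y

  child? : ∀ x y → Dec (Child x y)
  child? x y = (depth x ≟ suc (depth y)) ×-dec (parent x ≟ᶠ y)

  tree : Rel n
  tree x y = ⌊ child? x y ⌋ ∨ ⌊ child? y x ⌋

  tree-sym : ∀ x y → tree x y ≡ tree y x
  tree-sym x y = ∨-comm ⌊ child? x y ⌋ ⌊ child? y x ⌋

  tree⇒child : ∀ {x y} → tree x y ≡ true → Child x y ⊎ Child y x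
  tree⇒child {x} {y} e with child? x y | child? y x
  ... | yes c | _     = inj₁ c
  ... | no _  | yes c = inj₂ c

  child⇒tree : ∀ {x y} → Child x y → tree x y ≡ true
  child⇒tree {x} {y} c with child? x y
  ... | yes _ = refl
  ... | no ¬c = ⊥-elim (¬c c)

  child⇒tree⁻ : ∀ {x y} → Child x y → tree y x ≡ true
  child⇒tree⁻ {x} {y} c = trans (tree-sym y x) (child⇒tree c)

  -- y ⊑ x : y lies on the tree path from x up to the root.
  data _⊑_ : Fin n → Fin n → Set where
    ⊑-refl  : ∀ {x} → x ⊑ x
    ⊑-child : ∀ {x y z} → y ⊑ z → Child x z → y ⊑ x

  Comparable : Fin n → Fin n → Set
  Comparable x y = x ⊑ y ⊎ y ⊑ x

  ⊑-trans : ∀ {x y z} → x ⊑ y → y ⊑ z → x ⊑ z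
  ⊑-trans d ⊑-refl        = d
  ⊑-trans d (⊑-child e c) = ⊑-child (⊑-trans d e) c

  ⊑-parent : ∀ {x y} → Child x y → y ⊑ x
  ⊑-parent = ⊑-child ⊑-refl

  ⊑⇒depth≤ : ∀ {x y} → y ⊑ x → depth y ≤ depth x
  ⊑⇒depth≤ ⊑-refl               = ≤-refl
  ⊑⇒depth≤ (⊑-child d (dx , _)) = ≤-trans (⊑⇒depth≤ d) (≤-trans (n≤1+n _) (≤-reflexive (sym dx)))

  ⊑-same-depth⇒≡ : ∀ {x y} → y ⊑ x → depth x ≡ depth y → y ≡ x
  ⊑-same-depth⇒≡ ⊑-refl _ = refl
  ⊑-same-depth⇒≡ (⊑-child d (dx , _)) e =
    ⊥-elim (<-irrefl refl (≤-trans (s≤s (⊑⇒depth≤ d)) (≤-reflexive (trans (sym dx) e))))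

  ancestor-unique : ∀ {x y z} → y ⊑ x → z ⊑ x → depth y ≡ depth z → y ≡ z
  ancestor-unique ⊑-refl d e = sym (⊑-same-depth⇒≡ d e)
  ancestor-unique d ⊑-refl e = ⊑-same-depth⇒≡ d (sym e)
  ancestor-unique (⊑-child d (_ , refl)) (⊑-child d′ (_ , refl)) e = ancestor-unique d d′ e

  Ascending : ∀ {u v} → Walk tree u v → Set
  Ascending []                 = ⊤
  Ascending (_∷_ {u} {w} _ p) = Child u w × Ascending p

  Descending : ∀ {u v} → Walk tree u v → Set
  Descending []                 = ⊤
  Descending (_∷_ {u} {w} _ p) = Child w u × Descending p

  -- The walk climbs to w through the child c₁ and leaves it through another child c₂.
  Forked : Fin n → Fin n → Set
  Forked u v = Σ[ w ∈ Fin n ] Σ[ c₁ ∈ Fin n ] Σ[ c₂ ∈ Fin n ]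
    Child c₁ w × Child c₂ w × c₁ ≢ c₂ × c₁ ⊑ u × c₂ ⊑ v

  forked⇒incomparable : ∀ {u v} → Forked u v → ¬ Comparable u v
  forked⇒incomparable (w , c₁ , c₂ , (d₁ , _) , (d₂ , _) , c₁≢c₂ , c₁⊑u , c₂⊑v) u~v =
    c₁≢c₂ ([ (λ u⊑v → ancestor-unique (⊑-trans c₁⊑u u⊑v) c₂⊑v same-depth)
           , (λ v⊑u → ancestor-unique c₁⊑u (⊑-trans c₂⊑v v⊑u) same-depth) ]′ u~v)
    where
    same-depth : depth c₁ ≡ depth c₂
    same-depth = trans d₁ (sym d₂)

  descending⇒⊑ : ∀ {u v} (p : Walk tree u v) → Descending p → u ⊑ v
  descending⇒⊑ []      _        = ⊑-refl
  descending⇒⊑ (_ ∷ p) (c , ds) = ⊑-trans (⊑-parent c) (descending⇒⊑ p ds)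

  descending-onwards : ∀ {u w v} (e : tree u w ≡ true) (p : Walk tree w v) → Child w u →
    IsPath (e ∷ p) → Descending (e ∷ p)
  descending-onwards e []       c _ = c , tt
  descending-onwards e (e′ ∷ p) c ((_ ∷ u∉p) ∷ path) with tree⇒child e′
  ... | inj₁ (_ , refl) = ⊥-elim (All-vertices-head p u∉p (sym (proj₂ c)))
  ... | inj₂ c′         = c , descending-onwards e′ p c′ path

  ascending-then-descending : ∀ {u w v} (e : tree u w ≡ true) (p : Walk tree w v) → Child u w →
    Descending p → IsPath (e ∷ p) → Ascending (e ∷ p) ⊎ Forked u v
  ascending-then-descending e []       c _         _ = inj₁ (c , tt)
  ascending-then-descending {u} {w} e (_∷_ {w = x} _ p) c (c′ , ds) ((_ ∷ u∉p) ∷ _) =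
    inj₂ (w , u , x , c , c′ , All-vertices-head p u∉p , ⊑-refl , descending⇒⊑ p ds)

  path-shape : ∀ {u v} (p : Walk tree u v) → IsPath p →
    Ascending p ⊎ Descending p ⊎ Forked u v
  path-shape []      _    = inj₁ tt
  path-shape (e ∷ p) path with tree⇒child e
  ... | inj₂ c = inj₂ (inj₁ (descending-onwards e p c path))
  ... | inj₁ c with path-shape p (AllPairs.tail path)
  ...   | inj₁ as = inj₁ (c , as)
  ...   | inj₂ (inj₁ ds) = Sum.map₂ inj₂ (ascending-then-descending e p c ds path)
  ...   | inj₂ (inj₂ (w , c₁ , c₂ , ch₁ , ch₂ , c₁≢c₂ , c₁⊑ , c₂⊑)) =
          inj₂ (inj₂ (w , c₁ , c₂ , ch₁ , ch₂ , c₁≢c₂ , ⊑-child c₁⊑ c , c₂⊑))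

  path-monotone : ∀ {u v} (p : Walk tree u v) → IsPath p → Comparable u v →
    Ascending p ⊎ Descending p
  path-monotone p path u~v with path-shape p path
  ... | inj₁ as          = inj₁ as
  ... | inj₂ (inj₁ ds)   = inj₂ ds
  ... | inj₂ (inj₂ fork) = ⊥-elim (forked⇒incomparable fork u~v)

  sign : Fin n → Fin n → Bool
  sign x y = even (depth x ⊔ depth y)

  sign-sym : ∀ x y → sign x y ≡ sign y x
  sign-sym x y = cong even (⊔-comm (depth x) (depth y))

  sign-child : ∀ {x y} → Child x y → sign x y ≡ even (depth x)
  sign-child (dx , _) = cong even (m≥n⇒m⊔n≡m (≤-trans (n≤1+n _) (≤-reflexive (sym dx))))

  sign-parent : ∀ {x y} → Child y x → sign x y ≡ even (depth y)
  sign-parent {x} {y} c = trans (sign-sym x y) (sign-child c)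

  parity-flips : ∀ {x y} → Child x y → even (depth x) ≢ even (depth y)
  parity-flips (dx , _) eq = not-¬ refl (trans (sym eq) (cong even dx))

  ascending-alternates : ∀ {u v} (p : Walk tree u v) → Ascending p → AltWalk sign p
  ascending-alternates []           _ = tt
  ascending-alternates (_ ∷ [])     _ = tt
  ascending-alternates (e ∷ e′ ∷ p) (c , c′ , as) =
    (λ eq → parity-flips c (trans (sym (sign-child c)) (trans eq (sign-child c′))))
    , ascending-alternates (e′ ∷ p) (c′ , as)

  descending-alternates : ∀ {u v} (p : Walk tree u v) → Descending p → AltWalk sign p
  descending-alternates []           _ = tt
  descending-alternates (_ ∷ [])     _ = tt
  descending-alternates (e ∷ e′ ∷ p) (c , c′ , ds) =
    (λ eq → parity-flips c′ (trans (sym (sign-parent c′)) (trans (sym eq) (sign-parent c))))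
    , descending-alternates (e′ ∷ p) (c′ , ds)

  ascending-length : ∀ {u v} (p : Walk tree u v) → Ascending p → depth u ≡ len p + depth v
  ascending-length []      _             = refl
  ascending-length (_ ∷ p) ((du , _) , as) = trans du (cong suc (ascending-length p as))

  descending-length : ∀ {u v} (p : Walk tree u v) → Descending p → depth v ≡ len p + depth u
  descending-length []      _               = refl
  descending-length {u} {v} (_∷_ {w = w} _ p) ((dw , _) , ds) = begin
    depth v                ≡⟨ descending-length p ds ⟩
    len p + depth w        ≡⟨ cong (len p +_) dw ⟩
    len p + suc (depth u)  ≡⟨ +-suc (len p) (depth u) ⟩
    suc (len p + depth u)  ∎
    where open ≡-Reasoning

  tree-depths : ∀ {x y} → tree x y ≡ true → depth x ≡ suc (depth y) ⊎ depth y ≡ suc (depth x)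
  tree-depths = Sum.map proj₁ proj₁ ∘ tree⇒child

  tree⇒comparable : ∀ {x y} → tree x y ≡ true → Comparable x y
  tree⇒comparable = Sum.swap ∘ Sum.map ⊑-parent ⊑-parent ∘ tree⇒child

  tree-acyclic : Acyclic tree
  tree-acyclic (u , v , p , path , 2≤len , vu) = 2≰1 (subst (2 ≤_) len≡1 2≤len)
    where
    2≰1 : ¬ 2 ≤ 1
    2≰1 (s≤s ())
    len≡1 : len p ≡ 1
    len≡1 with path-monotone p path (Sum.swap (tree⇒comparable vu))
    ... | inj₁ as = gap-one (ascending-length p as) (Sum.swap (tree-depths vu))
    ... | inj₂ ds = gap-one (descending-length p ds) (tree-depths vu)

  ⊑⇒ascent : ∀ {x y} → y ⊑ x → Walk tree x y
  ⊑⇒ascent ⊑-refl        = []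
  ⊑⇒ascent (⊑-child d c) = child⇒tree c ∷ ⊑⇒ascent d

  ⊑⇒descent : ∀ {x y} → y ⊑ x → Walk tree y x
  ⊑⇒descent ⊑-refl        = []
  ⊑⇒descent (⊑-child d c) = ⊑⇒descent d ++ʷ (child⇒tree⁻ c ∷ [])

  record IsNormalSpanningTree (G : Graph n) (root : Fin n) : Set where
    field
      root-⊑    : ∀ x → root ⊑ x
      child-adj : ∀ {x y} → Child x y → adj G x y ≡ true
      normal    : ∀ {x y} → adj G x y ≡ true → Comparable x y

    isSpanningTree : IsSpanningTree G tree
    isSpanningTree = record
      { sub     = λ u v e → [ child-adj , (λ c → trans (adj-sym G u v) (child-adj c)) ]′ (tree⇒child e)
      ; T-sym   = tree-sym
      ; conn    = λ u v → ⊑⇒ascent (root-⊑ u) ++ʷ ⊑⇒descent (root-⊑ v)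
      ; acyclic = tree-acyclic
      }

    isAlternatingSign : IsAlternatingSign G tree sign
    isAlternatingSign =
        (λ u v _ → sign-sym u v)
      , λ u v uv _ p path →
          [ ascending-alternates p , descending-alternates p ]′ (path-monotone p path (normal uv))

NormalSpanningTree : ∀ {n} → Graph n → Fin n → Set
NormalSpanningTree {n} G root =
  Σ[ parent ∈ (Fin n → Fin n) ] Σ[ depth ∈ (Fin n → ℕ) ]
    TreeOrder.IsNormalSpanningTree parent depth G root

module Graft {n : ℕ} (parent : Fin n → Fin n) (depth : Fin n → ℕ) (y t : Fin n) where

  parent′ : Fin n → Fin n
  parent′ = updateAt parent y (const t)

  depth′ : Fin n → ℕ
  depth′ = updateAt depth y (const (suc (depth t)))

  open TreeOrder parent depth
  module New = TreeOrder parent′ depth′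

  parent′-grafted : parent′ y ≡ t
  parent′-grafted = updateAt-updates y parent

  parent′-elsewhere : ∀ {x} → x ≢ y → parent′ x ≡ parent x
  parent′-elsewhere {x} x≢y = updateAt-minimal x y parent x≢y

  depth′-elsewhere : ∀ {x} → x ≢ y → depth′ x ≡ depth x
  depth′-elsewhere {x} x≢y = updateAt-minimal x y depth x≢y

  grafted : t ≢ y → New.Child y t
  grafted t≢y = trans (updateAt-updates y depth) (cong suc (sym (depth′-elsewhere t≢y))) , parent′-grafted

  child-unchanged⁺ : ∀ {x z} → x ≢ y → z ≢ y → Child x z → New.Child x z
  child-unchanged⁺ x≢y z≢y (dx , px) =
      trans (depth′-elsewhere x≢y) (trans dx (cong suc (sym (depth′-elsewhere z≢y))))
    , trans (parent′-elsewhere x≢y) px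

  child-unchanged⁻ : ∀ {x z} → x ≢ y → z ≢ y → New.Child x z → Child x z
  child-unchanged⁻ x≢y z≢y (dx , px) =
      trans (sym (depth′-elsewhere x≢y)) (trans dx (cong suc (depth′-elsewhere z≢y)))
    , trans (sym (parent′-elsewhere x≢y)) px

  ⊑-unchanged : (P : Fin n → Set) → (∀ {x} → P x → P (parent x)) → ¬ P y →
    ∀ {x z} → P x → z ⊑ x → z New.⊑ x
  ⊑-unchanged P closed ¬Py px ⊑-refl = New.⊑-refl
  ⊑-unchanged P closed ¬Py px (⊑-child d c@(_ , refl)) =
    New.⊑-child (⊑-unchanged P closed ¬Py (closed px) d)
                (child-unchanged⁺ (avoids px) (avoids (closed px)) c)
    where
    avoids : ∀ {x} → P x → x ≢ y
    avoids px refl = ¬Py px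

-- Trémaux's depth-first search; U is the set of vertices not yet seen and the stack
-- holds the current root path, top first.
module DepthFirstSearch {n : ℕ} (G : Graph n) (G-connected : Connected (adj G)) (root : Fin n) where

  record State (U : Subset n) (stack : List (Fin n)) : Set where
    field
      parent : Fin n → Fin n
      depth  : Fin n → ℕ
    open TreeOrder parent depth
    field
      root-seen   : root ∉ U
      parent-seen : ∀ {x} → x ∉ U → parent x ∉ U
      root-⊑      : ∀ {x} → x ∉ U → root ⊑ x
      child-adj   : ∀ {x z} → x ∉ U → Child x z → adj G x z ≡ true
      normal      : ∀ {x z} → x ∉ U → z ∉ U → adj G x z ≡ true → Comparable x z
      frontier    : ∀ {x z} → x ∉ U → z ∈ U → adj G x z ≡ true → x ∈ₗ stack
      stack-seen  : All (_∉ U) stack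
      stack-chain : AllPairs (flip _⊑_) stack

  initial : State (∁ ⁅ root ⁆) (root ∷ [])
  initial = record
    { parent = id ; depth = const 0
    ; root-seen   = x∈p⇒x∉∁p (x∈⁅x⁆ root)
    ; parent-seen = id
    ; root-⊑      = λ x∉U → subst (_ ⊑_) (sym (seen⇒root x∉U)) ⊑-refl
    ; child-adj   = λ { _ (() , _) }
    ; normal      = λ x∉U z∉U _ → inj₁ (subst (_ ⊑_) (trans (seen⇒root x∉U) (sym (seen⇒root z∉U))) ⊑-refl)
    ; frontier    = λ x∉U _ _ → here (seen⇒root x∉U)
    ; stack-seen  = x∈p⇒x∉∁p (x∈⁅x⁆ root) ∷ []
    ; stack-chain = [] ∷ []
    }
    where
    open TreeOrder {n} id (const 0)
    seen⇒root : ∀ {x} → x ∉ ∁ ⁅ root ⁆ → x ≡ root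
    seen⇒root x∉U = x∈⁅y⁆⇒x≡y root (x∉∁p⇒x∈p x∉U)

  module Push {U t s} (st : State U (t ∷ s)) {y} (t~y : adj G t y ≡ true) (y∈U : y ∈ U) where
    open State st
    open TreeOrder parent depth
    open Graft parent depth y t

    seen⇒≢y : ∀ {x} → x ∉ U → x ≢ y
    seen⇒≢y x∉U refl = x∉U y∈U

    t-seen : t ∉ U
    t-seen = All.head stack-seen

    ⊑-kept : ∀ {x z} → x ∉ U → z ⊑ x → z New.⊑ x
    ⊑-kept = ⊑-unchanged (_∉ U) parent-seen (λ y∉U → y∉U y∈U)

    y-child-of-t : New.Child y t
    y-child-of-t = grafted (seen⇒≢y t-seen)

    stack-below-t : ∀ {x} → x ∈ₗ t ∷ s → x ⊑ t
    stack-below-t (here refl)  = ⊑-refl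
    stack-below-t (there x∈ₗs) = All.lookup (AllPairs.head stack-chain) x∈ₗs

    stack-below-y : ∀ {x} → x ∈ₗ t ∷ s → x New.⊑ y
    stack-below-y x∈ₗ = New.⊑-child (⊑-kept t-seen (stack-below-t x∈ₗ)) y-child-of-t

    chain-kept : ∀ {l} → All (_∉ U) l → AllPairs (flip _⊑_) l → AllPairs (flip New._⊑_) l
    chain-kept []           []               = []
    chain-kept (x∉U ∷ seen) (below ∷ chain) = All.map (⊑-kept x∉U) below ∷ chain-kept seen chain

    parent-seen′ : ∀ {x} → x ∉ U - y → parent′ x ∉ U - y
    parent-seen′ x∉ with x∉p-y⇒x≡y⊎x∉p x∉
    ... | inj₁ refl = subst (_∉ U - y) (sym parent′-grafted) (x∉p⇒x∉p-y t-seen)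
    ... | inj₂ x∉U  = subst (_∉ U - y) (sym (parent′-elsewhere (seen⇒≢y x∉U))) (x∉p⇒x∉p-y (parent-seen x∉U))

    root-⊑′ : ∀ {x} → x ∉ U - y → root New.⊑ x
    root-⊑′ x∉ with x∉p-y⇒x≡y⊎x∉p x∉
    ... | inj₁ refl = New.⊑-child (⊑-kept t-seen (root-⊑ t-seen)) y-child-of-t
    ... | inj₂ x∉U  = ⊑-kept x∉U (root-⊑ x∉U)

    child-adj′ : ∀ {x z} → x ∉ U - y → New.Child x z → adj G x z ≡ true
    child-adj′ {x} {z} x∉ c@(_ , px≡z) with x∉p-y⇒x≡y⊎x∉p x∉
    ... | inj₁ refl = subst (λ z → adj G y z ≡ true) (trans (sym parent′-grafted) px≡z)
                            (trans (adj-sym G y t) t~y)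
    ... | inj₂ x∉U  = child-adj x∉U (child-unchanged⁻ x≢y (seen⇒≢y z∉U) c)
      where
      x≢y : x ≢ y
      x≢y = seen⇒≢y x∉U
      z∉U : z ∉ U
      z∉U = subst (_∉ U) (trans (sym (parent′-elsewhere x≢y)) px≡z) (parent-seen x∉U)

    -- By the frontier invariant, the seen neighbours of y lie on the stack, i.e. are ancestors of y.
    normal′ : ∀ {x z} → x ∉ U - y → z ∉ U - y → adj G x z ≡ true → New.Comparable x z
    normal′ x∉ z∉ x~z with x∉p-y⇒x≡y⊎x∉p x∉ | x∉p-y⇒x≡y⊎x∉p z∉
    ... | inj₁ refl | inj₁ refl = inj₁ New.⊑-refl
    ... | inj₁ refl | inj₂ z∉U  = inj₂ (stack-below-y (frontier z∉U y∈U (trans (adj-sym G _ y) x~z)))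
    ... | inj₂ x∉U  | inj₁ refl = inj₁ (stack-below-y (frontier x∉U y∈U x~z))
    ... | inj₂ x∉U  | inj₂ z∉U  = Sum.map (⊑-kept z∉U) (⊑-kept x∉U) (normal x∉U z∉U x~z)

    frontier′ : ∀ {x z} → x ∉ U - y → z ∈ U - y → adj G x z ≡ true → x ∈ₗ y ∷ t ∷ s
    frontier′ x∉ z∈ x~z with x∉p-y⇒x≡y⊎x∉p x∉
    ... | inj₁ x≡y = here x≡y
    ... | inj₂ x∉U = there (frontier x∉U (p─q⊆p U ⁅ y ⁆ z∈) x~z)

    pushed : State (U - y) (y ∷ t ∷ s)
    pushed = record
      { parent = parent′ ; depth = depth′
      ; root-seen   = x∉p⇒x∉p-y root-seen
      ; parent-seen = parent-seen′
      ; root-⊑      = root-⊑′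
      ; child-adj   = child-adj′
      ; normal      = normal′
      ; frontier    = frontier′
      ; stack-seen  = x∉p-x y U ∷ All.map x∉p⇒x∉p-y stack-seen
      ; stack-chain = All.tabulate stack-below-y ∷ chain-kept stack-seen stack-chain
      }

  UnseenNeighbour : Subset n → Fin n → Set
  UnseenNeighbour U t = ∃[ y ] adj G t y ≡ true × y ∈ U

  unseenNeighbour? : ∀ U t → Dec (UnseenNeighbour U t)
  unseenNeighbour? U t = any? (λ y → (adj G t y ≟ᵇ true) ×-dec (y ∈? U))

  pop : ∀ {U t s} → State U (t ∷ s) → ¬ UnseenNeighbour U t → State U s
  pop {U} {t} {s} st none = record
    { parent = parent ; depth = depth
    ; root-seen = root-seen ; parent-seen = parent-seen ; root-⊑ = root-⊑
    ; child-adj = child-adj ; normal = normal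
    ; frontier    = frontier′
    ; stack-seen  = All.tail stack-seen
    ; stack-chain = AllPairs.tail stack-chain
    }
    where
    open State st
    frontier′ : ∀ {x z} → x ∉ U → z ∈ U → adj G x z ≡ true → x ∈ₗ s
    frontier′ x∉U z∈U x~z with frontier x∉U z∈U x~z
    ... | here refl  = ⊥-elim (none (_ , x~z , z∈U))
    ... | there x∈ₗs = x∈ₗs

  finish : ∀ {U} → State U [] → NormalSpanningTree G root
  finish {U} st = parent , depth , record
    { root-⊑    = λ x → root-⊑ (seen x)
    ; child-adj = λ {x} → child-adj (seen x)
    ; normal    = λ {x} {z} → normal (seen x) (seen z)
    }
    where
    open State st
    seen-along : ∀ {x z} → Walk (adj G) x z → x ∉ U → z ∉ U
    seen-along []      x∉U = x∉U
    seen-along (e ∷ p) x∉U = seen-along p (λ w∈U → ∉[] (frontier x∉U w∈U e))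
    seen : ∀ x → x ∉ U
    seen x = seen-along (G-connected root x) root-seen

  -- Terminates lexicographically: a push removes a vertex from U, a pop shortens the stack.
  search : ∀ {U s} → Acc _<_ ∣ U ∣ → State U s → NormalSpanningTree G root
  advance : ∀ {U t s} → Acc _<_ ∣ U ∣ → State U (t ∷ s) → Dec (UnseenNeighbour U t) →
    NormalSpanningTree G root

  search {s = []}        _   st = finish st
  search {U} {s = t ∷ _} rec st = advance rec st (unseenNeighbour? U t)

  advance (acc smaller) st (yes (_ , t~y , y∈U)) =
    search (smaller (x∈p⇒∣p-x∣<∣p∣ y∈U)) (Push.pushed st t~y y∈U)
  advance rec st (no none) = search rec (pop st none)

  normalSpanningTree : NormalSpanningTree G root
  normalSpanningTree = search (<-wellFounded _) initial

theorem2p2 : ∀ (n : ℕ) (G : Graph n) → Connected (adj G) →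
    Σ (Fin n → Fin n → Bool) λ T → IsSpanningTree G T ×
      Σ (Fin n → Fin n → Bool) λ φ → IsAlternatingSign G T φ
theorem2p2 zero    G _ =
  (λ ()) , record { sub = λ () ; T-sym = λ () ; conn = λ () ; acyclic = λ { (() , _) } }
  , (λ ()) , (λ ()) , (λ ())
theorem2p2 (suc n) G G-connected
  with DepthFirstSearch.normalSpanningTree G G-connected zero
... | parent , depth , isNormal = tree , isSpanningTree , sign , isAlternatingSign
  where
  open TreeOrder parent depth
  open IsNormalSpanningTree isNormal
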